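{- Let $M$ be a $C$-algebra with $T,F,U$. If $M_{\#}$ is non-atomic, then $M$ is non-atomic.
   Context: A $C$-algebra is an algebra $\langle M,\vee,\wedge,\neg\rangle$ of type $(2,2,1)$ satisfying, for all $\alpha,\beta,\gamma$: $\neg\neg\alpha=\alpha$; $\neg(\alpha\wedge\beta)=\neg\alpha\vee\neg\beta$; $(\alpha\wedge\beta)\wedge\gamma=\alpha\wedge(\beta\wedge\gamma)$; $\alpha\wedge(\beta\vee\gamma)=(\alpha\wedge\beta)\vee(\alpha\wedge\gamma)$; $(\alpha\vee\beta)\wedge\gamma=(\alpha\wedge\gamma)\vee(\neg\alpha\wedge\beta\wedge\gamma)$; $\alpha\vee(\alpha\wedge\beta)=\alpha$; $(\alpha\wedge\beta)\vee(\beta\wedge\alpha)=(\beta\wedge\alpha)\vee(\alpha\wedge\beta)$. A $C$-algebra with $T,F,U$ has nullary operations $T,F,U$ where $T$ is the two-sided identity for $\wedge$, $F$ the two-sided identity for $\vee$, and $U$ the fixed point of $\neg$. $M_{\#} = \{\alpha \in M : \alpha\vee\neg\alpha = T\}$ (a Boolean algebra under the induced operations, containing $T,F$). Order: $a\leq b$ iff $a\vee b=b$. For a subset $A\subseteq M$ containing $F$, the atoms relative to $A$ are the $a \in A$, $a\neq F$, such that every $b\in A$ with $F\leq b\leq a$, $b\neq a$ equals $F$ (for $A=M$ these are the atoms of $M$). For finitely many elements $a_1,\dots,a_N$: if $a_{\sigma(1)}\vee\cdots\vee a_{\sigma(N)} = a_1\vee\cdots\vee a_N$ for every bijection $\sigma$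 of $\{1,\dots,N\}$, then $\bigoplus_{i=1}^N a_i$ exists and equals this value. $A$ (either $M$ or $M_\#$) is atomic if every $a\in A$, $a\neq F$, equals $\bigoplus_{i=1}^N a_i$ for some finite set of atoms relative to $A$; non-atomic means not atomic. -}

module Defs where

open import Level using (Level; suc; _⊔_; Lift)
open import Data.Unit using (⊤)
open import Data.Nat using (ℕ; zero) renaming (suc to sucℕ)
open import Data.Fin using (Fin) renaming (zero to fz; suc to fs)
open import Data.Fin.Permutation using (Permutation′; _⟨$⟩ʳ_)
open import Data.Product using (Σ; _×_; ∃)
open import Function using (_∘_)
open import Function.Definitions using (Injective)
open import Relation.Binary.PropositionalEquality using (_≡_; _≢_)
open import Relation.Nullary using (¬_)

-- A C-algebra with T, F, U (equality is propositional equality on the carrier).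
record CAlgebraTFU (c : Level) : Set (suc c) where
  infixr 6 _∧_
  infixr 5 _∨_
  field
    Carrier : Set c
    _∨_ : Carrier → Carrier → Carrier
    _∧_ : Carrier → Carrier → Carrier
    ¬ₘ  : Carrier → Carrier
    T F U : Carrier
    ¬¬-inv    : ∀ α → ¬ₘ (¬ₘ α) ≡ α
    deMorgan  : ∀ α β → ¬ₘ (α ∧ β) ≡ (¬ₘ α ∨ ¬ₘ β)
    ∧-assoc   : ∀ α β γ → ((α ∧ β) ∧ γ) ≡ (α ∧ (β ∧ γ))
    ∧-distribˡ : ∀ α β γ → (α ∧ (β ∨ γ)) ≡ ((α ∧ β) ∨ (α ∧ γ))
    ∨-∧-distribʳ : ∀ α β γ → ((α ∨ β) ∧ γ) ≡ ((α ∧ γ) ∨ (¬ₘ α ∧ β ∧ γ))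
    absorb    : ∀ α β → (α ∨ (α ∧ β)) ≡ α
    ∧-∨-comm  : ∀ α β → ((α ∧ β) ∨ (β ∧ α)) ≡ ((β ∧ α) ∨ (α ∧ β))
    T-identityˡ : ∀ α → (T ∧ α) ≡ α
    T-identityʳ : ∀ α → (α ∧ T) ≡ α
    F-identityˡ : ∀ α → (F ∨ α) ≡ α
    F-identityʳ : ∀ α → (α ∨ F) ≡ α
    U-fixed   : ¬ₘ U ≡ U

module _ {c : Level} (M : CAlgebraTFU c) where
  open CAlgebraTFU M

  Sharp : Carrier → Set c
  Sharp α = (α ∨ ¬ₘ α) ≡ T

  Whole : Carrier → Set c
  Whole _ = Lift c ⊤

  _≤ₘ_ : Carrier → Carrier → Set c
  a ≤ₘ b = (a ∨ b) ≡ b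

  -- atoms relative to a subset A (A is assumed to contain F)
  AtomRel : (Carrier → Set c) → Carrier → Set c
  AtomRel A a = A a × (a ≢ F) ×
    (∀ b → A b → F ≤ₘ b → b ≤ₘ a → b ≢ a → b ≡ F)

  bigJoin : {n : ℕ} → (Fin (sucℕ n) → Carrier) → Carrier
  bigJoin {zero}   a = a fz
  bigJoin {sucℕ n} a = a fz ∨ bigJoin (a ∘ fs)

  -- ⊕_{i} a_i exists and equals x
  IsOplus : {n : ℕ} → (Fin (sucℕ n) → Carrier) → Carrier → Set c
  IsOplus {n} a x =
    (∀ (σ : Permutation′ (sucℕ n)) → bigJoin (λ i → a (σ ⟨$⟩ʳ i)) ≡ bigJoin a)
    × (x ≡ bigJoin a)

  Atomic : (Carrier → Set c) → Set c
  Atomic A = ∀ a → A a → a ≢ F →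
    Σ ℕ λ n → Σ (Fin (sucℕ n) → Carrier) λ as →
      Injective _≡_ _≡_ as × (∀ i → AtomRel A (as i)) × IsOplus as a

  NonAtomic : (Carrier → Set c) → Set c
  NonAtomic A = ¬ Atomic A

-- If M is atomic then so is M_#; Theorem 2.45 is the contrapositive.
--
-- Let a ∈ M_#, a ≠ F, and write a = ⊕ᵢ aᵢ with atoms aᵢ of M.  Two facts
-- turn this into a decomposition of a inside M_#:
--   * every summand of an ⊕ lies below it (the ⊕ is invariant under the
--     transposition moving aᵢ to the front, and the head of a join is below
--     the join), so aᵢ ≤ a;
--   * M_# is closed downwards: b ≤ a and a ∨ ¬a = T give b ∨ T = T,
--     and b ∨ T = T already forces b ∨ ¬b = T.
-- Hence each aᵢ lies in M_#, and an atom relative to M that lies in a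
-- smaller subset is an atom relative to that subset.
module Submission where

open import Defs
open import Level using (Level; lift)
open import Data.Nat using (zero) renaming (suc to sucℕ)
open import Data.Fin using (Fin) renaming (zero to fz; suc to fs)
open import Data.Fin.Permutation using (Permutation′; _⟨$⟩ʳ_; transpose)
open import Data.Fin.Properties using (_≟_)
open import Relation.Nullary.Decidable using (dec-true)
open import Data.Product using (_,_)
open import Relation.Binary.PropositionalEquality

transpose-zero : ∀ {n} (i : Fin (sucℕ n)) → transpose fz i ⟨$⟩ʳ fz ≡ i
transpose-zero {n} i rewrite dec-true (_≟_ {sucℕ n} fz fz) refl = refl

module _ {c : Level} (M : CAlgebraTFU c) where
  open CAlgebraTFU M
  open ≡-Reasoning

  -- ∨ is idempotent: a ∨ a = a ∨ (a ∧ T) = a by absorption.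
  ∨-idem : ∀ a → (a ∨ a) ≡ a
  ∨-idem a = trans (cong (a ∨_) (sym (T-identityʳ a))) (absorb a T)

  ¬-injective : ∀ {a b} → ¬ₘ a ≡ ¬ₘ b → a ≡ b
  ¬-injective {a} {b} e = trans (sym (¬¬-inv a)) (trans (cong ¬ₘ e) (¬¬-inv b))

  deMorgan-∨ : ∀ a b → ¬ₘ (a ∨ b) ≡ (¬ₘ a ∧ ¬ₘ b)
  deMorgan-∨ a b = begin
    ¬ₘ (a ∨ b)                  ≡⟨ cong ¬ₘ (cong₂ _∨_ (sym (¬¬-inv a)) (sym (¬¬-inv b))) ⟩
    ¬ₘ (¬ₘ (¬ₘ a) ∨ ¬ₘ (¬ₘ b))  ≡⟨ cong ¬ₘ (sym (deMorgan (¬ₘ a) (¬ₘ b))) ⟩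
    ¬ₘ (¬ₘ (¬ₘ a ∧ ¬ₘ b))        ≡⟨ ¬¬-inv _ ⟩
    (¬ₘ a ∧ ¬ₘ b)               ∎

  -- ∨ is associative: negate, use associativity of ∧, negate back.
  ∨-assoc : ∀ a b d → ((a ∨ b) ∨ d) ≡ (a ∨ (b ∨ d))
  ∨-assoc a b d = ¬-injective (begin
    ¬ₘ ((a ∨ b) ∨ d)         ≡⟨ deMorgan-∨ _ _ ⟩
    (¬ₘ (a ∨ b) ∧ ¬ₘ d)      ≡⟨ cong (_∧ ¬ₘ d) (deMorgan-∨ a b) ⟩
    ((¬ₘ a ∧ ¬ₘ b) ∧ ¬ₘ d)   ≡⟨ ∧-assoc _ _ _ ⟩
    (¬ₘ a ∧ (¬ₘ b ∧ ¬ₘ d))   ≡⟨ cong (¬ₘ a ∧_) (sym (deMorgan-∨ b d)) ⟩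
    (¬ₘ a ∧ ¬ₘ (b ∨ d))      ≡⟨ sym (deMorgan-∨ _ _) ⟩
    ¬ₘ (a ∨ (b ∨ d))         ∎)

  ≤-∨ʳ : ∀ {a b} x → _≤ₘ_ M b a → _≤ₘ_ M b (a ∨ x)
  ≤-∨ʳ {a} {b} x b≤a = trans (sym (∨-assoc b a x)) (cong (_∨ x) b≤a)

  -- Anything below T is in M_# (not every element is: U ∨ T = U).
  ≤T⇒sharp : ∀ b → _≤ₘ_ M b T → Sharp M b
  ≤T⇒sharp b b≤T = begin
    (b ∨ ¬ₘ b)                   ≡⟨ sym (cong₂ _∨_ (T-identityʳ b) (T-identityʳ (¬ₘ b))) ⟩
    ((b ∧ T) ∨ (¬ₘ b ∧ T))       ≡⟨ cong (λ t → (b ∧ T) ∨ (¬ₘ b ∧ t)) (sym (T-identityʳ T)) ⟩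
    ((b ∧ T) ∨ (¬ₘ b ∧ T ∧ T))   ≡⟨ sym (∨-∧-distribʳ b T T) ⟩
    ((b ∨ T) ∧ T)                ≡⟨ T-identityʳ _ ⟩
    (b ∨ T)                      ≡⟨ b≤T ⟩
    T                            ∎

  sharp-downward : ∀ {a b} → _≤ₘ_ M b a → Sharp M a → Sharp M b
  sharp-downward {a} {b} b≤a sharp-a =
    ≤T⇒sharp b (subst (_≤ₘ_ M b) sharp-a (≤-∨ʳ (¬ₘ a) b≤a))

  head-≤-bigJoin : ∀ {n} (as : Fin (sucℕ n) → Carrier) → _≤ₘ_ M (as fz) (bigJoin M as)
  head-≤-bigJoin {zero}   as = ∨-idem _
  head-≤-bigJoin {sucℕ n} as =
    trans (sym (∨-assoc _ _ _)) (cong (_∨ bigJoin M (λ i → as (fs i))) (∨-idem _))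

  -- Every summand of an ⊕ lies below it: move it to the front by a
  -- transposition, which does not change the join.
  summand-≤-⊕ : ∀ {n} {as : Fin (sucℕ n) → Carrier} {x} →
    IsOplus M as x → ∀ i → _≤ₘ_ M (as i) x
  summand-≤-⊕ {as = as} (perm-invariant , refl) i =
    subst (λ j → _≤ₘ_ M (as j) (bigJoin M as)) (transpose-zero i)
      (subst (_≤ₘ_ M (as (σ ⟨$⟩ʳ fz))) (perm-invariant σ)
        (head-≤-bigJoin (λ j → as (σ ⟨$⟩ʳ j))))
    where
    σ : Permutation′ _
    σ = transpose fz i

  atom-restrict : ∀ {A B : Carrier → Set c} → (∀ {x} → A x → B x) →
    ∀ {a} → AtomRel M B a → A a → AtomRel M A a
  atom-restrict A⊆B (_ , a≢F , minimal) a∈A =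
    a∈A , a≢F , λ b b∈A → minimal b (A⊆B b∈A)

  atomic⇒sharp-atomic : Atomic M (Whole M) → Atomic M (Sharp M)
  atomic⇒sharp-atomic atomic a sharp-a a≢F
    with atomic a (lift _) a≢F
  ... | n , as , injective , atoms , oplus =
    n , as , injective ,
    (λ i → atom-restrict (λ _ → lift _) (atoms i)
             (sharp-downward (summand-≤-⊕ oplus i) sharp-a)) ,
    oplus

theorem2p45 : ∀ {c : Level} (M : CAlgebraTFU c) →
    NonAtomic M (Sharp M) → NonAtomic M (Whole M)
theorem2p45 M sharp-nonatomic atomic =
  sharp-nonatomic (atomic⇒sharp-atomic M atomic)
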